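{- Let $m\ge1$ and $W=W^{(m)}_4$. Then $B_0\cap B_1=\emptyset$, and consequently the map $f:A\to B$ is a bijection.
   Context: $W^{(m)}_4$ is the set of sequences $\gamma=(\gamma_0,\gamma_1,\gamma_2,\gamma_3)$ of nonnegative integers with $\gamma_0=0$ and $\gamma_i\le\gamma_{i-1}+m$ for $i=1,2,3$. For $\gamma\in W$, let $r=r(\gamma)$ be the least $i\in\{2,3\}$ with $\gamma_i-\gamma_{i-2}\le m$, or $r=4$ if none exists. $A_0$ is the set of $\gamma\in W$ with $\gamma_{r-1}-1\le\gamma_3+m$ and $\gamma_1>0$; for $\gamma\in A_0$, $f_0(\gamma)=(\gamma_0,\dots,\gamma_{r-2},\gamma_r,\dots,\gamma_3,\gamma_{r-1}-1)$, and $B_0=f_0(A_0)\subseteq W$. $A_1=\{(0,\gamma_1,\gamma_2,\gamma_3)\in W:\gamma_2-\gamma_3>m+1\}$, $f_1(0,\gamma_1,\gamma_2,\gamma_3)=(0,\gamma_3+1,\gamma_1-1,\gamma_2-1)$ for $\gamma\in A_1$, and $B_1=f_1(A_1)$. (One has $A_0\cap A_1=\emptyset$.) Set $A=A_0\cup A_1$, $B=B_0\cup B_1$, and $f:A\to B$ given by $f=f_0$ on $A_0$ and $f=f_1$ on $A_1$. -}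

module Defs where

open import Data.Nat using (ℕ; zero; suc; _+_; _∸_; _≤_; _<_; _≤?_)
open import Data.Product using (Σ; ∃; _×_; _,_; proj₁)
open import Data.Sum using (_⊎_; inj₁; inj₂)
open import Relation.Nullary using (yes; no)
open import Relation.Binary.PropositionalEquality using (_≡_)

Seq : Set
Seq = ℕ × ℕ × ℕ × ℕ

W : ℕ → Seq → Set
W m (g0 , g1 , g2 , g3) = (g0 ≡ 0) × (g1 ≤ g0 + m) × (g2 ≤ g1 + m) × (g3 ≤ g2 + m)

data R : Set where
  r2 r3 r4 : R

-- r(γ): least i ∈ {2,3} with γ_i − γ_{i−2} ≤ m, else 4.
-- (Truncated subtraction ∸ agrees with the integer inequality here.)
r : ℕ → Seq → R
r m (g0 , g1 , g2 , g3) with (g2 ∸ g0) ≤? m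
... | yes _ = r2
... | no _ with (g3 ∸ g1) ≤? m
...   | yes _ = r3
...   | no _ = r4

γr-1 : R → Seq → ℕ
γr-1 r2 (g0 , g1 , g2 , g3) = g1
γr-1 r3 (g0 , g1 , g2 , g3) = g2
γr-1 r4 (g0 , g1 , g2 , g3) = g3

A0 : ℕ → Seq → Set
A0 m γ@(g0 , g1 , g2 , g3) = W m γ × (γr-1 (r m γ) γ ∸ 1 ≤ g3 + m) × (0 < g1)

f0-at : R → Seq → Seq
f0-at r2 (g0 , g1 , g2 , g3) = (g0 , g2 , g3 , g1 ∸ 1)
f0-at r3 (g0 , g1 , g2 , g3) = (g0 , g1 , g3 , g2 ∸ 1)
f0-at r4 (g0 , g1 , g2 , g3) = (g0 , g1 , g2 , g3 ∸ 1)

f0 : ℕ → Seq → Seq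
f0 m γ = f0-at (r m γ) γ

B0 : ℕ → Seq → Set
B0 m β = ∃ λ γ → A0 m γ × (f0 m γ ≡ β)

-- A₁ (γ₀ = 0 is part of W)
A1 : ℕ → Seq → Set
A1 m γ@(g0 , g1 , g2 , g3) = W m γ × (suc m < g2 ∸ g3)

f1 : Seq → Seq
f1 (g0 , g1 , g2 , g3) = (0 , suc g3 , g1 ∸ 1 , g2 ∸ 1)

B1 : ℕ → Seq → Set
B1 m β = ∃ λ γ → A1 m γ × (f1 γ ≡ β)

A : ℕ → Seq → Set
A m γ = A0 m γ ⊎ A1 m γ

B : ℕ → Seq → Set
B m β = B0 m β ⊎ B1 m β

f : (m : ℕ) → Σ Seq (A m) → Seq
f m (γ , inj₁ _) = f0 m γ
f m (γ , inj₂ _) = f1 γ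

-- f is a bijection from the set A onto the set B (sets = predicates on Seq;
-- injectivity compares the underlying sequences).
IsBijectionAB : ℕ → Set
IsBijectionAB m =
  ((a : Σ Seq (A m)) → B m (f m a))
  × ((a a′ : Σ Seq (A m)) → f m a ≡ f m a′ → proj₁ a ≡ proj₁ a′)
  × ((β : Seq) → B m β → ∃ λ (a : Σ Seq (A m)) → f m a ≡ β)

module Submission where

-- f has an explicit left inverse f⁻¹.  For β = f(γ) the value β₃ + 1 is the
-- removed entry γ_{r−1} (or γ₂ when γ ∈ A₁), and comparing it with m and β₁ + m, and
-- β₂ with m, tells which of r = 2, 3, 4 or the map f₁ produced β.  Hence f is injective
-- on A, and B₀ ∩ B₁ = ∅ follows from A₀ ∩ A₁ = ∅, which is the only place where the
-- condition γ_{r−1} − 1 ≤ γ₃ + m defining A₀ is used.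

open import Defs
open import Data.Nat using (ℕ; zero; suc; pred; _+_; _∸_; _≤_; _<_; _≤?_; _<?_; s≤s)
open import Data.Nat.Properties
  using (≤-trans; <-trans; ≤-<-trans; <-asym; <⇒≱; ≰⇒>; m≤n+m; m≤m+n; n≤1+n; n<1+n; +-suc; m≤n+o⇒m∸n≤o)
open import Data.Product using (Σ; _×_; _,_; proj₁)
open import Data.Sum using (inj₁; inj₂)
open import Function using (_∘_)
open import Relation.Nullary using (¬_; yes; no; contradiction)
open import Relation.Binary.PropositionalEquality using (_≡_; refl; sym; trans; cong; subst)

data RCase (m g1 g2 g3 : ℕ) : R → Set where
  case2 : g2 ≤ m → RCase m g1 g2 g3 r2
  case3 : m < g2 → RCase m g1 g2 g3 r3
  case4 : m < g2 → g1 + m < g3 → RCase m g1 g2 g3 r4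

rCase : ∀ m g1 g2 g3 → RCase m g1 g2 g3 (r m (0 , g1 , g2 , g3))
rCase m g1 g2 g3 with g2 ≤? m
... | yes g2≤m = case2 g2≤m
... | no g2≰m with g3 ∸ g1 ≤? m
...   | yes _ = case3 (≰⇒> g2≰m)
...   | no g3∸g1≰m = case4 (≰⇒> g2≰m) (≰⇒> (g3∸g1≰m ∘ m≤n+o⇒m∸n≤o g3 g1))

A1-gap : ∀ {m g2 g3} → suc m < g2 ∸ g3 → suc (g3 + m) < g2
A1-gap {m} {g2} {g3} gap = subst (_< g2) (+-suc g3 m)
  (≰⇒> (<⇒≱ gap ∘ m≤n+o⇒m∸n≤o g2 g3))

f⁻¹ : ℕ → Seq → Seq
f⁻¹ m (_ , b1 , b2 , b3) with suc b3 ≤? m | suc b3 ≤? b1 + m | m <? b2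
... | yes _ | _     | _     = (0 , suc b3 , b1 , b2)
... | no _  | yes _ | _     = (0 , b1 , suc b3 , b2)
... | no _  | no _  | yes _ = (0 , b1 , b2 , suc b3)
... | no _  | no _  | no _  = (0 , suc b2 , suc b3 , pred b1)

module _ {m b1 b2 b3 : ℕ} where

  private
    above-m : b1 + m < suc b3 → ¬ (suc b3 ≤ m)
    above-m lt le = <⇒≱ lt (≤-trans le (m≤n+m m b1))

  f⁻¹-reinsert₁ : suc b3 ≤ m → f⁻¹ m (0 , b1 , b2 , b3) ≡ (0 , suc b3 , b1 , b2)
  f⁻¹-reinsert₁ le with suc b3 ≤? m | suc b3 ≤? b1 + m | m <? b2
  ... | yes _ | _ | _ = refl
  ... | no ≰  | _ | _ = contradiction le ≰

  f⁻¹-reinsert₂ : m < suc b3 → suc b3 ≤ b1 + m → f⁻¹ m (0 , b1 , b2 , b3) ≡ (0 , b1 , suc b3 , b2)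
  f⁻¹-reinsert₂ lt le with suc b3 ≤? m | suc b3 ≤? b1 + m | m <? b2
  ... | yes le′ | _     | _ = contradiction le′ (<⇒≱ lt)
  ... | no _    | yes _ | _ = refl
  ... | no _    | no ≰  | _ = contradiction le ≰

  f⁻¹-reinsert₃ : b1 + m < suc b3 → m < b2 → f⁻¹ m (0 , b1 , b2 , b3) ≡ (0 , b1 , b2 , suc b3)
  f⁻¹-reinsert₃ lt m<b2 with suc b3 ≤? m | suc b3 ≤? b1 + m | m <? b2
  ... | yes le | _      | _     = contradiction le (above-m lt)
  ... | no _   | yes le | _     = contradiction le (<⇒≱ lt)
  ... | no _   | no _   | yes _ = refl
  ... | no _   | no _   | no ≮  = contradiction m<b2 ≮

  f⁻¹-undo-f1 : b1 + m < suc b3 → b2 < m → f⁻¹ m (0 , b1 , b2 , b3) ≡ (0 , suc b2 , suc b3 , pred b1)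
  f⁻¹-undo-f1 lt b2<m with suc b3 ≤? m | suc b3 ≤? b1 + m | m <? b2
  ... | yes le | _      | _       = contradiction le (above-m lt)
  ... | no _   | yes le | _       = contradiction le (<⇒≱ lt)
  ... | no _   | no _   | yes lt′ = contradiction lt′ (<-asym b2<m)
  ... | no _   | no _   | no _    = refl

f⁻¹∘f0-at : ∀ {m g1 g2 g3 ρ} → RCase m g1 g2 g3 ρ → g1 ≤ m → g2 ≤ g1 + m → 0 < g1 →
  f⁻¹ m (f0-at ρ (0 , g1 , g2 , g3)) ≡ (0 , g1 , g2 , g3)
f⁻¹∘f0-at (case2 _) g1≤m _ (s≤s _) = f⁻¹-reinsert₁ g1≤m
f⁻¹∘f0-at {g2 = suc _} (case3 m<g2) _ g2≤g1+m _ = f⁻¹-reinsert₂ m<g2 g2≤g1+m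
f⁻¹∘f0-at {g3 = suc _} (case4 m<g2 g1+m<g3) _ _ _ = f⁻¹-reinsert₃ g1+m<g3 m<g2

f⁻¹∘f1 : ∀ {m g1 g2 g3} → g1 ≤ m → g2 ≤ g1 + m → suc (g3 + m) < g2 →
  f⁻¹ m (f1 (0 , g1 , g2 , g3)) ≡ (0 , g1 , g2 , g3)
f⁻¹∘f1 {m} {g1 = zero} _ g2≤m gap =
  contradiction g2≤m (<⇒≱ (≤-<-trans (m≤n+m m _) (<-trans (n<1+n _) gap)))
f⁻¹∘f1 {g1 = suc _} {suc _} g1≤m _ gap = f⁻¹-undo-f1 gap g1≤m

f⁻¹∘f : ∀ m (a : Σ Seq (A m)) → f⁻¹ m (f m a) ≡ proj₁ a
f⁻¹∘f m ((_ , g1 , g2 , g3) , inj₁ ((refl , g1≤m , g2≤g1+m , _) , _ , 0<g1)) =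
  f⁻¹∘f0-at (rCase m g1 g2 g3) g1≤m g2≤g1+m 0<g1
f⁻¹∘f m ((_ , _ , _ , _) , inj₂ ((refl , g1≤m , g2≤g1+m , _) , gap)) =
  f⁻¹∘f1 g1≤m g2≤g1+m (A1-gap gap)

f-injective : ∀ m (a a′ : Σ Seq (A m)) → f m a ≡ f m a′ → proj₁ a ≡ proj₁ a′
f-injective m a a′ eq = trans (sym (f⁻¹∘f m a)) (trans (cong (f⁻¹ m) eq) (f⁻¹∘f m a′))

A0∩A1-at : ∀ {m g1 g2 g3 ρ} → RCase m g1 g2 g3 ρ → γr-1 ρ (0 , g1 , g2 , g3) ∸ 1 ≤ g3 + m →
  g2 ≤ g1 + m → ¬ (suc (g3 + m) < g2)
A0∩A1-at {m} (case2 g2≤m) _ _ gap = <⇒≱ gap (≤-trans g2≤m (≤-trans (m≤n+m m _) (n≤1+n _)))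
A0∩A1-at {g2 = suc _} (case3 _) removed≤ _ (s≤s gap) = <⇒≱ gap removed≤
A0∩A1-at {m} (case4 _ g1+m<g3) _ g2≤g1+m gap =
  <⇒≱ (<-trans gap (≤-<-trans g2≤g1+m g1+m<g3)) (≤-trans (m≤m+n _ m) (n≤1+n _))

A0-A1-disjoint : ∀ {m} γ → A0 m γ → ¬ A1 m γ
A0-A1-disjoint {m} (_ , g1 , g2 , g3) ((refl , _) , removed≤ , _) ((_ , _ , g2≤g1+m , _) , gap) =
  A0∩A1-at (rCase m g1 g2 g3) removed≤ g2≤g1+m (A1-gap gap)

B0-B1-disjoint : ∀ m β → ¬ (B0 m β × B1 m β)
B0-B1-disjoint m _ ((γ , γ∈A0 , refl) , (δ , δ∈A1 , eq)) =
  A0-A1-disjoint δ (subst (A0 m) γ≡δ γ∈A0) δ∈A1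
  where
  γ≡δ : γ ≡ δ
  γ≡δ = f-injective m (γ , inj₁ γ∈A0) (δ , inj₂ δ∈A1) (sym eq)

lemma4p3 : (m : ℕ) → 1 ≤ m →
    ((β : Seq) → ¬ (B0 m β × B1 m β)) × IsBijectionAB m
lemma4p3 m _ = B0-B1-disjoint m , f-into-B , f-injective m , f-onto-B
  where
  f-into-B : (a : Σ Seq (A m)) → B m (f m a)
  f-into-B (γ , inj₁ γ∈A0) = inj₁ (γ , γ∈A0 , refl)
  f-into-B (γ , inj₂ γ∈A1) = inj₂ (γ , γ∈A1 , refl)

  f-onto-B : (β : Seq) → B m β → Σ (Σ Seq (A m)) λ a → f m a ≡ β
  f-onto-B _ (inj₁ (γ , γ∈A0 , eq)) = (γ , inj₁ γ∈A0) , eq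
  f-onto-B _ (inj₂ (γ , γ∈A1 , eq)) = (γ , inj₂ γ∈A1) , eq
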